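{- Let $\mathbb{F}$ be a field of characteristic $0$, $n\in\mathbb{N}$, $\varkappa\in\mathbb{N}^n$ (all $\varkappa_j\ge1$), $s\in\{1,\ldots,n\}$ and $r\in\{1,\ldots,\varkappa_s\}$. Then the following identity holds in $\mathbb{F}(y_1,\ldots,y_n)$: \[ A_{y,\varkappa,s,r}=(-1)^{|\varkappa|-r}\,y_s^{r-\varkappa_s}\Bigl(\prod_{d\in\{1,\ldots,n\}\setminus\{s\}}y_d^{ -\varkappa_d}\Bigr)B_{1/y,\varkappa,s,r}, \] where $1/y=(1/y_1,\ldots,1/y_n)$, i.e. $B_{1/y,\varkappa,s,r}$ is $B_{y,\varkappa,s,r}$ with each $y_j$ replaced by $1/y_j$.
   Context: $|\varkappa|=\varkappa_1+\cdots+\varkappa_n$. For variables $x_1,\ldots,x_M$, $\operatorname{h}_k(x_1,\ldots,x_M)=\sum_{j\in\mathbb{N}_0^M,\ |j|=k}x_1^{j_1}\cdots x_M^{j_M}$. Let $w$ (resp. $z$) be the list obtained by listing, for $d=1,\ldots,n$ with $d\ne s$ in increasing order, the element $y_d/(y_d-y_s)$ (resp. $1/(y_d-y_s)$) repeated $\varkappa_d$ times. Define \[ A_{y,\varkappa,s,r}=\frac{(-y_s)^{|\varkappa|-\varkappa_s}}{\prod_{d\ne s}(y_d-y_s)^{\varkappa_d}}\operatorname{h}_{\varkappa_s-r}(w),\qquad B_{y,\varkappa,s,r}=(-1)^{|\varkappa|-\varkappa_s}\Bigl(\prod_{d\ne s}(y_d-y_s)^{ -\varkappa_d}\Bigr)\operatorname{h}_{\varkappa_s-r}(z).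 \] -}

module Defs where

open import Level using (Level; suc; _⊔_)
open import Algebra.Bundles using (CommutativeRing)
open import Relation.Nullary using (¬_)
open import Relation.Binary.PropositionalEquality using (_≡_)
open import Data.Nat as ℕ using (ℕ; zero)
open import Data.Fin as Fin using (Fin)
open import Data.Vec as Vec using (Vec; []; _∷_)
open import Data.List as List using (List; []; _∷_; _++_; concatMap; replicate; allFin; filter)
open import Relation.Nullary.Decidable using (¬?)
open import Data.Nat.ListAction renaming (sum to ℕsum)

record Field (c ℓ : Level) : Set (suc (c ⊔ ℓ)) where
  field
    commutativeRing : CommutativeRing c ℓ
  open CommutativeRing commutativeRing public
  field
    _⁻¹       : Carrier → Carrier
    1≉0       : ¬ (1# ≈ 0#)
    ⁻¹-inverse : ∀ x → ¬ (x ≈ 0#) → (x * (x ⁻¹)) ≈ 1#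

module FieldDefs {c ℓ : Level} (F : Field c ℓ) where
  open Field F

  ofℕ : ℕ → Carrier
  ofℕ zero      = 0#
  ofℕ (ℕ.suc m) = 1# + ofℕ m

  CharZero : Set ℓ
  CharZero = ∀ m → ¬ (ofℕ (ℕ.suc m) ≈ 0#)

  infixl 7 _/_
  infixr 8 _^_

  _/_ : Carrier → Carrier → Carrier
  x / y = x * (y ⁻¹)

  _^_ : Carrier → ℕ → Carrier
  x ^ zero      = 1#
  x ^ ℕ.suc k   = x * (x ^ k)

  sumL : List Carrier → Carrier
  sumL = List.foldr _+_ 0#

  prodL : List Carrier → Carrier
  prodL = List.foldr _*_ 1#

  -- all j ∈ ℕ^M with |j| = k
  compositions : (M k : ℕ) → List (Vec ℕ M)
  compositions zero    zero      = [] ∷ []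
  compositions zero    (ℕ.suc k) = []
  compositions (ℕ.suc M) k =
    concatMap (λ i → List.map (λ v → (k ℕ.∸ i) ∷ v) (compositions M i))
              (List.upTo (ℕ.suc k))

  monomial : ∀ {M} → Vec Carrier M → Vec ℕ M → Carrier
  monomial []       []       = 1#
  monomial (x ∷ xs) (j ∷ js) = (x ^ j) * monomial xs js

  h : ℕ → List Carrier → Carrier
  h k xs = sumL (List.map (monomial (Vec.fromList xs))
                          (compositions (List.length xs) k))

  module _ {n : ℕ} where
    others : Fin n → List (Fin n)
    others s = filter (λ d → ¬? (d Fin.≟ s)) (allFin n)

    size : (Fin n → ℕ) → ℕ
    size κ = ℕsum (List.map κ (allFin n))

    listing : (Fin n → ℕ) → Fin n → (Fin n → Carrier) → List Carrier
    listing κ s f = concatMap (λ d → replicate (κ d) (f d)) (others s)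

    A : (y : Fin n → Carrier) (κ : Fin n → ℕ) (s : Fin n) (r : ℕ) → Carrier
    A y κ s r =
      ((- y s) ^ (size κ ℕ.∸ κ s))
        / prodL (List.map (λ d → (y d - y s) ^ κ d) (others s))
      * h (κ s ℕ.∸ r) (listing κ s (λ d → y d / (y d - y s)))

    B : (y : Fin n → Carrier) (κ : Fin n → ℕ) (s : Fin n) (r : ℕ) → Carrier
    B y κ s r =
      ((- 1#) ^ (size κ ℕ.∸ κ s))
      * prodL (List.map (λ d → ((y d - y s) ^ κ d) ⁻¹) (others s))
      * h (κ s ℕ.∸ r) (listing κ s (λ d → 1# / (y d - y s)))

-- Put a = y_s and t_d = y_d - a.  Inverting the variables turns 1/(y_d - y_s) into
-- 1/(1/y_d - 1/a) = -a y_d / t_d, so the list fed to h in B(1/y) is the list of A scaled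
-- by -a, and homogeneity of h_{κ_s - r} contributes (-a)^{κ_s - r}.  Likewise
-- y_d^{-κ_d} (1/y_d - 1/a)^{-κ_d} = (-a / t_d)^{κ_d}, so both sides reduce to
-- (-a)^{|κ| - κ_s} ∏_{d ≠ s} t_d^{-κ_d} h_{κ_s - r}(y_d / t_d), once the signs and the power
-- of a cancel.
module Submission where

open import Defs
open import Level using (Level)
open import Relation.Nullary using (¬_)
open import Relation.Binary.PropositionalEquality using (_≡_)
open import Data.Nat using (ℕ; _≤_; _∸_)
open import Data.Fin using (Fin)
open import Data.List using (map)

open import Data.Nat as ℕ using (zero; suc)
import Data.Nat.Properties as ℕₚ
open import Data.Nat.ListAction using () renaming (sum to ℕsum)
import Data.Fin as Fin
open import Data.List using (List; []; _∷_; _++_; concatMap; replicate; filter; upTo; length; allFin)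
import Data.List.Properties as List
open import Data.List.Membership.Propositional using (_∈_)
open import Data.List.Membership.Propositional.Properties using (∈-allFin)
open import Data.List.Relation.Unary.Any using (here; there)
open import Data.List.Relation.Unary.All as All using (All; []; _∷_)
open import Data.List.Relation.Unary.All.Properties using (all-filter; applyUpTo⁺₁)
open import Data.List.Relation.Unary.Unique.Propositional using (Unique; _∷_)
open import Data.List.Relation.Unary.Unique.Propositional.Properties using (allFin⁺)
open import Data.List.Relation.Binary.Pointwise as Pointwise using (Pointwise; []; _∷_)
open import Data.Vec using (Vec; _∷_; fromList)
open import Function using (_∘_; id)
open import Relation.Binary.Definitions using (DecidableEquality)
open import Relation.Binary.PropositionalEquality using (_≢_)
import Relation.Binary.PropositionalEquality as ≡
open import Relation.Nullary.Decidable using (¬?)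
import Algebra.Properties.CommutativeSemigroup as CommutativeSemigroupProperties
import Algebra.Properties.CommutativeSemiring.Exp as Exp
import Algebra.Properties.Group as GroupProperties
import Algebra.Properties.Ring as RingProperties
import Algebra.Solver.CommutativeMonoid as CommutativeMonoidSolver
import Relation.Binary.Reasoning.Setoid as SetoidReasoning

module _ {a} {A : Set a} (_≟_ : DecidableEquality A) (κ : A → ℕ) where

  delete : A → List A → List A
  delete x = filter (λ z → ¬? (z ≟ x))

  sum-delete : ∀ {x xs} → Unique xs → x ∈ xs →
               ℕsum (map κ xs) ≡ κ x ℕ.+ ℕsum (map κ (delete x xs))
  sum-delete {x} {x ∷ zs} (x∉zs ∷ _) (here ≡.refl) =
    ≡.cong (λ ws → κ x ℕ.+ ℕsum (map κ ws)) (≡.sym (≡.trans delete-head zs-unchanged))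
    where
    delete-head : delete x (x ∷ zs) ≡ delete x zs
    delete-head = List.filter-reject (λ z → ¬? (z ≟ x)) (λ x≢x → x≢x ≡.refl)
    zs-unchanged : delete x zs ≡ zs
    zs-unchanged = List.filter-all (λ z → ¬? (z ≟ x)) (All.map (λ x≢z z≡x → x≢z (≡.sym z≡x)) x∉zs)
  sum-delete {x} {z ∷ zs} (z∉zs ∷ unique) (there x∈zs) = begin
    κ z ℕ.+ ℕsum (map κ zs)                        ≡⟨ ≡.cong (κ z ℕ.+_) (sum-delete unique x∈zs) ⟩
    κ z ℕ.+ (κ x ℕ.+ ℕsum (map κ (delete x zs)))   ≡⟨ x∙yz≈y∙xz (κ z) (κ x) _ ⟩
    κ x ℕ.+ (κ z ℕ.+ ℕsum (map κ (delete x zs)))   ≡⟨ ≡.cong (λ ws → κ x ℕ.+ ℕsum (map κ ws))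
                                                        (≡.sym (List.filter-accept (λ w → ¬? (w ≟ x)) (All.lookup z∉zs x∈zs))) ⟩
    κ x ℕ.+ ℕsum (map κ (delete x (z ∷ zs)))       ∎
    where
    open ≡.≡-Reasoning
    open CommutativeSemigroupProperties ℕₚ.+-commutativeSemigroup using (x∙yz≈y∙xz)

concatMap-replicate⁺ : ∀ {a b c r} {A : Set a} {B : Set b} {C : Set c} {R : A → B → Set r}
                       (κ : C → ℕ) {f : C → A} {g : C → B} {ds : List C} →
                       All (λ d → R (f d) (g d)) ds →
                       Pointwise R (concatMap (λ d → replicate (κ d) (f d)) ds)
                                   (concatMap (λ d → replicate (κ d) (g d)) ds)
concatMap-replicate⁺ κ []       = []
concatMap-replicate⁺ κ (r ∷ rs) = Pointwise.++⁺ (Pointwise.replicate⁺ r (κ _)) (concatMap-replicate⁺ κ rs)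

module _ {c ℓ : Level} (F : Field c ℓ) where
  open Field F
  open FieldDefs F
  open SetoidReasoning setoid
  open RingProperties ring using (-1*x≈-x; -‿distribˡ-*; -‿distribʳ-*; [y-z]x≈yx-zx)
  open GroupProperties +-group using (x∙y⁻¹≈ε⇒x≈y) renaming (⁻¹-involutive to -‿involutive)
  open CommutativeSemigroupProperties *-commutativeSemigroup using (interchange; xy∙z≈y∙zx)
  open CommutativeMonoidSolver *-commutativeMonoid using (solve; _⊜_; _⊕_)
  private
    module Lib = Exp commutativeSemiring

  ^≡^ : ∀ x k → x ^ k ≡ x Lib.^ k
  ^≡^ x zero    = ≡.refl
  ^≡^ x (suc k) = ≡.cong (x *_) (^≡^ x k)

  ^-congˡ : ∀ k {x y} → x ≈ y → x ^ k ≈ y ^ k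
  ^-congˡ k {x} {y} x≈y rewrite ^≡^ x k | ^≡^ y k = Lib.^-congˡ k x≈y

  ^-homo-* : ∀ x m n → x ^ (m ℕ.+ n) ≈ x ^ m * x ^ n
  ^-homo-* x m n rewrite ^≡^ x (m ℕ.+ n) | ^≡^ x m | ^≡^ x n = Lib.^-homo-* x m n

  ^-distrib-* : ∀ x y k → (x * y) ^ k ≈ x ^ k * y ^ k
  ^-distrib-* x y k rewrite ^≡^ (x * y) k | ^≡^ x k | ^≡^ y k = Lib.^-distrib-* x y k

  1^k≈1 : ∀ k → 1# ^ k ≈ 1#
  1^k≈1 zero    = refl
  1^k≈1 (suc k) = trans (*-identityˡ _) (1^k≈1 k)

  [-1]^k*[-x]^k≈x^k : ∀ k x → (- 1#) ^ k * (- x) ^ k ≈ x ^ k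
  [-1]^k*[-x]^k≈x^k k x = begin
    (- 1#) ^ k * (- x) ^ k  ≈⟨ ^-distrib-* (- 1#) (- x) k ⟨
    (- 1# * - x) ^ k        ≈⟨ ^-congˡ k (trans (-1*x≈-x (- x)) (-‿involutive x)) ⟩
    x ^ k                   ∎

  [-1]^k*[-1]^k≈1 : ∀ k → (- 1#) ^ k * (- 1#) ^ k ≈ 1#
  [-1]^k*[-1]^k≈1 k = trans ([-1]^k*[-x]^k≈x^k k 1#) (1^k≈1 k)

  x⁻¹*[x*y]≈y : ∀ {x} y → x ≉ 0# → x ⁻¹ * (x * y) ≈ y
  x⁻¹*[x*y]≈y {x} y x≉0 = begin
    x ⁻¹ * (x * y)  ≈⟨ *-assoc (x ⁻¹) x y ⟨
    x ⁻¹ * x * y    ≈⟨ *-congʳ (trans (*-comm (x ⁻¹) x) (⁻¹-inverse x x≉0)) ⟩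
    1# * y          ≈⟨ *-identityˡ y ⟩
    y               ∎

  *-nonzero : ∀ {x y} → x ≉ 0# → y ≉ 0# → x * y ≉ 0#
  *-nonzero {x} {y} x≉0 y≉0 x*y≈0 = y≉0 (begin
    y               ≈⟨ x⁻¹*[x*y]≈y y x≉0 ⟨
    x ⁻¹ * (x * y)  ≈⟨ *-congˡ x*y≈0 ⟩
    x ⁻¹ * 0#       ≈⟨ zeroʳ (x ⁻¹) ⟩
    0#              ∎)

  ^-nonzero : ∀ {x} k → x ≉ 0# → x ^ k ≉ 0#
  ^-nonzero zero    x≉0 = 1≉0
  ^-nonzero (suc k) x≉0 = *-nonzero x≉0 (^-nonzero k x≉0)

  inverseʳ-unique : ∀ {x y} → x ≉ 0# → x * y ≈ 1# → y ≈ x ⁻¹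
  inverseʳ-unique {x} {y} x≉0 x*y≈1 = begin
    y               ≈⟨ x⁻¹*[x*y]≈y y x≉0 ⟨
    x ⁻¹ * (x * y)  ≈⟨ *-congˡ x*y≈1 ⟩
    x ⁻¹ * 1#       ≈⟨ *-identityʳ (x ⁻¹) ⟩
    x ⁻¹            ∎

  ⁻¹-distrib-* : ∀ {x y} → x ≉ 0# → y ≉ 0# → (x * y) ⁻¹ ≈ x ⁻¹ * y ⁻¹
  ⁻¹-distrib-* {x} {y} x≉0 y≉0 = sym (inverseʳ-unique (*-nonzero x≉0 y≉0) (begin
    x * y * (x ⁻¹ * y ⁻¹)    ≈⟨ interchange x y (x ⁻¹) (y ⁻¹) ⟩
    x * x ⁻¹ * (y * y ⁻¹)    ≈⟨ *-cong (⁻¹-inverse x x≉0) (⁻¹-inverse y y≉0) ⟩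
    1# * 1#                  ≈⟨ *-identityˡ 1# ⟩
    1#                       ∎))

  x*y≈z⇒x⁻¹≈y/z : ∀ {x y z} → z ≉ 0# → x * y ≈ z → x ⁻¹ ≈ y / z
  x*y≈z⇒x⁻¹≈y/z {x} {y} {z} z≉0 x*y≈z = sym (inverseʳ-unique x≉0 (begin
    x * (y * z ⁻¹)  ≈⟨ *-assoc x y (z ⁻¹) ⟨
    x * y * z ⁻¹    ≈⟨ *-congʳ x*y≈z ⟩
    z * z ⁻¹        ≈⟨ ⁻¹-inverse z z≉0 ⟩
    1#              ∎))
    where
    x≉0 : x ≉ 0#
    x≉0 x≈0 = z≉0 (trans (sym x*y≈z) (trans (*-congʳ x≈0) (zeroˡ y)))

  [y⁻¹-x⁻¹][-x*y]≈y-x : ∀ {x y} → x ≉ 0# → y ≉ 0# → (y ⁻¹ - x ⁻¹) * (- x * y) ≈ y - x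
  [y⁻¹-x⁻¹][-x*y]≈y-x {x} {y} x≉0 y≉0 = begin
    (y ⁻¹ - x ⁻¹) * (- x * y)                ≈⟨ [y-z]x≈yx-zx (- x * y) (y ⁻¹) (x ⁻¹) ⟩
    y ⁻¹ * (- x * y) - x ⁻¹ * (- x * y)      ≈⟨ +-cong (*-congˡ (*-comm (- x) y)) (-‿cong (*-congˡ -x*y≈x*-y)) ⟩
    y ⁻¹ * (y * - x) - x ⁻¹ * (x * - y)      ≈⟨ +-cong (x⁻¹*[x*y]≈y (- x) y≉0) (-‿cong (x⁻¹*[x*y]≈y (- y) x≉0)) ⟩
    - x - - y                                ≈⟨ +-congˡ (-‿involutive y) ⟩
    - x + y                                  ≈⟨ +-comm (- x) y ⟩
    y - x                                    ∎
    where
    -x*y≈x*-y : - x * y ≈ x * - y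
    -x*y≈x*-y = trans (sym (-‿distribˡ-* x y)) (-‿distribʳ-* x y)

  sign-cancel : ∀ {a} → a ≉ 0# → ∀ S m p q z →
    (- 1#) ^ (S ℕ.+ m) * (a ^ m) ⁻¹ * p * ((- 1#) ^ S * q * ((- a) ^ m * z)) ≈ p * q * z
  sign-cancel {a} a≉0 S m p q z = begin
    (- 1#) ^ (S ℕ.+ m) * (a ^ m) ⁻¹ * p * ((- 1#) ^ S * q * ((- a) ^ m * z))
      ≈⟨ *-congʳ (*-congʳ (*-congʳ (^-homo-* (- 1#) S m))) ⟩
    (- 1#) ^ S * (- 1#) ^ m * (a ^ m) ⁻¹ * p * ((- 1#) ^ S * q * ((- a) ^ m * z))
      ≈⟨ solve 7 (λ e e′ i p q g z → (((e ⊕ e′) ⊕ i) ⊕ p) ⊕ ((e ⊕ q) ⊕ (g ⊕ z))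
                                  ⊜ ((e ⊕ e) ⊕ ((e′ ⊕ g) ⊕ i)) ⊕ ((p ⊕ q) ⊕ z))
               refl ((- 1#) ^ S) ((- 1#) ^ m) ((a ^ m) ⁻¹) p q ((- a) ^ m) z ⟩
    (- 1#) ^ S * (- 1#) ^ S * ((- 1#) ^ m * (- a) ^ m * (a ^ m) ⁻¹) * (p * q * z)
      ≈⟨ *-congʳ (*-cong ([-1]^k*[-1]^k≈1 S) (*-congʳ ([-1]^k*[-x]^k≈x^k m a))) ⟩
    1# * (a ^ m * (a ^ m) ⁻¹) * (p * q * z)
      ≈⟨ *-congʳ (trans (*-identityˡ _) (⁻¹-inverse (a ^ m) (^-nonzero m a≉0))) ⟩
    1# * (p * q * z)
      ≈⟨ *-identityˡ (p * q * z) ⟩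
    p * q * z
      ∎

  sumL-++ : ∀ xs ys → sumL (xs ++ ys) ≈ sumL xs + sumL ys
  sumL-++ []       ys = sym (+-identityˡ _)
  sumL-++ (x ∷ xs) ys = trans (+-congˡ (sumL-++ xs ys)) (sym (+-assoc x _ _))

  module _ {a} {A : Set a} where

    sumL-cong : ∀ {f g : A → Carrier} {is} → All (λ i → f i ≈ g i) is → sumL (map f is) ≈ sumL (map g is)
    sumL-cong []       = refl
    sumL-cong (e ∷ es) = +-cong e (sumL-cong es)

    *-distribˡ-sumL : ∀ x (f : A → Carrier) is → sumL (map (λ i → x * f i) is) ≈ x * sumL (map f is)
    *-distribˡ-sumL x f []       = sym (zeroʳ x)
    *-distribˡ-sumL x f (i ∷ is) = trans (+-congˡ (*-distribˡ-sumL x f is)) (sym (distribˡ x _ _))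

    sumL-concatMap : ∀ (f : A → List Carrier) is → sumL (concatMap f is) ≈ sumL (map (sumL ∘ f) is)
    sumL-concatMap f []       = refl
    sumL-concatMap f (i ∷ is) = trans (sumL-++ (f i) _) (+-congˡ (sumL-concatMap f is))

    prodL-cong : ∀ {f g : A → Carrier} {is} → All (λ i → f i ≈ g i) is → prodL (map f is) ≈ prodL (map g is)
    prodL-cong []       = refl
    prodL-cong (e ∷ es) = *-cong e (prodL-cong es)

    prodL-distrib-* : ∀ (f g : A → Carrier) is →
                      prodL (map (λ i → f i * g i) is) ≈ prodL (map f is) * prodL (map g is)
    prodL-distrib-* f g []       = sym (*-identityˡ 1#)
    prodL-distrib-* f g (i ∷ is) = trans (*-congˡ (prodL-distrib-* f g is)) (interchange (f i) (g i) _ _)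

    prodL-^ : ∀ x (κ : A → ℕ) is → prodL (map (λ i → x ^ κ i) is) ≈ x ^ ℕsum (map κ is)
    prodL-^ x κ []       = refl
    prodL-^ x κ (i ∷ is) = trans (*-congˡ (prodL-^ x κ is)) (sym (^-homo-* x (κ i) _))

    prodL-nonzero : ∀ {f : A → Carrier} {is} → All (λ i → f i ≉ 0#) is → prodL (map f is) ≉ 0#
    prodL-nonzero []         = 1≉0
    prodL-nonzero (f≉0 ∷ fs) = *-nonzero f≉0 (prodL-nonzero fs)

    prodL-⁻¹ : ∀ {f : A → Carrier} {is} → All (λ i → f i ≉ 0#) is →
               prodL (map (λ i → f i ⁻¹) is) ≈ prodL (map f is) ⁻¹
    prodL-⁻¹ []         = inverseʳ-unique 1≉0 (*-identityˡ 1#)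
    prodL-⁻¹ (f≉0 ∷ fs) = trans (*-congˡ (prodL-⁻¹ fs)) (sym (⁻¹-distrib-* f≉0 (prodL-nonzero fs)))

  h-cons : ∀ k x xs → h k (x ∷ xs) ≈ sumL (map (λ i → x ^ (k ∸ i) * h i xs) (upTo (suc k)))
  h-cons k x xs = begin
    sumL (map (monomial (x ∷ v)) (concatMap prepend is))          ≡⟨ ≡.cong sumL (List.map-concatMap _ prepend is) ⟩
    sumL (concatMap (map (monomial (x ∷ v)) ∘ prepend) is)        ≈⟨ sumL-concatMap (map (monomial (x ∷ v)) ∘ prepend) is ⟩
    sumL (map (sumL ∘ map (monomial (x ∷ v)) ∘ prepend) is)       ≈⟨ sumL-cong (All.universal leading-power is) ⟩
    sumL (map (λ i → x ^ (k ∸ i) * h i xs) is)                    ∎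
    where
    v : Vec Carrier (length xs)
    v = fromList xs
    is : List ℕ
    is = upTo (suc k)
    prepend : ℕ → List (Vec ℕ (suc (length xs)))
    prepend i = map ((k ∸ i) ∷_) (compositions (length xs) i)
    leading-power : ∀ i → sumL (map (monomial (x ∷ v)) (prepend i)) ≈ x ^ (k ∸ i) * h i xs
    leading-power i = trans (reflexive (≡.cong sumL (≡.sym (List.map-∘ (compositions (length xs) i)))))
                            (*-distribˡ-sumL (x ^ (k ∸ i)) (monomial v) (compositions (length xs) i))

  h-homogeneous : ∀ a {xs′ xs} → Pointwise (λ x′ x → x′ ≈ a * x) xs′ xs → ∀ k → h k xs′ ≈ a ^ k * h k xs
  h-homogeneous a []                   zero    = sym (*-identityˡ _)
  h-homogeneous a []                   (suc k) = sym (zeroʳ _)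
  h-homogeneous a {x′ ∷ xs′} {x ∷ xs} (x′≈ax ∷ xs′≈axs) k = begin
    h k (x′ ∷ xs′)                                              ≈⟨ h-cons k x′ xs′ ⟩
    sumL (map (λ i → x′ ^ (k ∸ i) * h i xs′) (upTo (suc k)))    ≈⟨ sumL-cong (applyUpTo⁺₁ id (suc k) (term ∘ ℕₚ.≤-pred)) ⟩
    sumL (map (λ i → a ^ k * (x ^ (k ∸ i) * h i xs)) (upTo (suc k)))
                                                                ≈⟨ *-distribˡ-sumL (a ^ k) _ (upTo (suc k)) ⟩
    a ^ k * sumL (map (λ i → x ^ (k ∸ i) * h i xs) (upTo (suc k)))
                                                                ≈⟨ *-congˡ (h-cons k x xs) ⟨
    a ^ k * h k (x ∷ xs)                                        ∎
    where
    term : ∀ {i} → i ≤ k → x′ ^ (k ∸ i) * h i xs′ ≈ a ^ k * (x ^ (k ∸ i) * h i xs)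
    term {i} i≤k = begin
      x′ ^ (k ∸ i) * h i xs′                        ≈⟨ *-cong (^-congˡ (k ∸ i) x′≈ax) (h-homogeneous a xs′≈axs i) ⟩
      (a * x) ^ (k ∸ i) * (a ^ i * h i xs)          ≈⟨ *-congʳ (^-distrib-* a x (k ∸ i)) ⟩
      a ^ (k ∸ i) * x ^ (k ∸ i) * (a ^ i * h i xs)  ≈⟨ interchange _ _ _ _ ⟩
      a ^ (k ∸ i) * a ^ i * (x ^ (k ∸ i) * h i xs)  ≈⟨ *-congʳ (^-homo-* a (k ∸ i) i) ⟨
      a ^ (k ∸ i ℕ.+ i) * (x ^ (k ∸ i) * h i xs)    ≡⟨ ≡.cong (λ e → a ^ e * (x ^ (k ∸ i) * h i xs)) (ℕₚ.m∸n+n≡m i≤k) ⟩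
      a ^ k * (x ^ (k ∸ i) * h i xs)                ∎

  size-others : ∀ {n} (κ : Fin n → ℕ) s → size κ ≡ κ s ℕ.+ ℕsum (map κ (others s))
  size-others {n} κ s = sum-delete Fin._≟_ κ (allFin⁺ n) (∈-allFin s)

  module Normalisation {n} (κ : Fin n → ℕ) (s : Fin n) (y : Fin n → Carrier)
                       (y≉0 : ∀ j → y j ≉ 0#) (y-injective : ∀ i j → i ≢ j → y i ≉ y j) where

    a : Carrier
    a = y s

    t u : Fin n → Carrier
    t d = y d - a
    u d = y d ⁻¹ - a ⁻¹

    S : ℕ
    S = ℕsum (map κ (others s))

    I Q₁ Q₂ : Carrier
    I  = prodL (map (λ d → (t d ^ κ d) ⁻¹) (others s))
    Q₁ = prodL (map (λ d → (y d ^ κ d) ⁻¹) (others s))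
    Q₂ = prodL (map (λ d → (u d ^ κ d) ⁻¹) (others s))

    H : ℕ → Carrier
    H m = h m (listing κ s (λ d → y d / t d))

    size∸κs≡S : size κ ∸ κ s ≡ S
    size∸κs≡S = ≡.trans (≡.cong (_∸ κ s) (size-others κ s)) (ℕₚ.m+n∸m≡n (κ s) S)

    size∸r≡S+κs∸r : ∀ {r} → r ≤ κ s → size κ ∸ r ≡ S ℕ.+ (κ s ∸ r)
    size∸r≡S+κs∸r {r} r≤κs = ≡.trans (≡.cong (_∸ r) (≡.trans (size-others κ s) (ℕₚ.+-comm (κ s) S)))
                                  (ℕₚ.+-∸-assoc S r≤κs)

    others-avoid-s : All (_≢ s) (others s)
    others-avoid-s = all-filter (λ d → ¬? (d Fin.≟ s)) (allFin n)

    t≉0 : ∀ {d} → d ≢ s → t d ≉ 0#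
    t≉0 {d} d≢s t≈0 = y-injective d s d≢s (x∙y⁻¹≈ε⇒x≈y (y d) a t≈0)

    u*[-a*y]≈t : ∀ d → u d * (- a * y d) ≈ t d
    u*[-a*y]≈t d = [y⁻¹-x⁻¹][-x*y]≈y-x (y≉0 s) (y≉0 d)

    u≉0 : ∀ {d} → d ≢ s → u d ≉ 0#
    u≉0 {d} d≢s u≈0 = t≉0 d≢s (trans (sym (u*[-a*y]≈t d)) (trans (*-congʳ u≈0) (zeroˡ _)))

    1/u≈-a*[y/t] : ∀ {d} → d ≢ s → 1# / u d ≈ - a * (y d / t d)
    1/u≈-a*[y/t] {d} d≢s = begin
      1# * u d ⁻¹               ≈⟨ *-identityˡ _ ⟩
      u d ⁻¹                    ≈⟨ x*y≈z⇒x⁻¹≈y/z (t≉0 d≢s) (u*[-a*y]≈t d) ⟩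
      - a * y d * t d ⁻¹        ≈⟨ *-assoc (- a) (y d) (t d ⁻¹) ⟩
      - a * (y d * t d ⁻¹)      ∎

    [y^κ]⁻¹*[u^κ]⁻¹≈[-a]^κ*[t^κ]⁻¹ : ∀ {d} → d ≢ s → (y d ^ κ d) ⁻¹ * (u d ^ κ d) ⁻¹ ≈ (- a) ^ κ d * (t d ^ κ d) ⁻¹
    [y^κ]⁻¹*[u^κ]⁻¹≈[-a]^κ*[t^κ]⁻¹ {d} d≢s = begin
      (y d ^ k) ⁻¹ * (u d ^ k) ⁻¹   ≈⟨ ⁻¹-distrib-* (^-nonzero k (y≉0 d)) (^-nonzero k (u≉0 d≢s)) ⟨
      (y d ^ k * u d ^ k) ⁻¹        ≈⟨ x*y≈z⇒x⁻¹≈y/z (^-nonzero k (t≉0 d≢s)) product ⟩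
      (- a) ^ k * (t d ^ k) ⁻¹      ∎
      where
      k : ℕ
      k = κ d
      product : y d ^ k * u d ^ k * (- a) ^ k ≈ t d ^ k
      product = begin
        y d ^ k * u d ^ k * (- a) ^ k   ≈⟨ *-congʳ (^-distrib-* (y d) (u d) k) ⟨
        (y d * u d) ^ k * (- a) ^ k     ≈⟨ ^-distrib-* (y d * u d) (- a) k ⟨
        (y d * u d * - a) ^ k           ≈⟨ ^-congˡ k (trans (xy∙z≈y∙zx (y d) (u d) (- a)) (u*[-a*y]≈t d)) ⟩
        t d ^ k                         ∎

    A-normal : ∀ r → A y κ s r ≈ (- a) ^ S * I * H (κ s ∸ r)
    A-normal r = *-congʳ (*-cong (reflexive (≡.cong ((- a) ^_) size∸κs≡S))
                                 (sym (prodL-⁻¹ (All.map (λ {d} d≢s → ^-nonzero (κ d) (t≉0 d≢s)) others-avoid-s))))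

    Q₁*Q₂≈[-a]^S*I : Q₁ * Q₂ ≈ (- a) ^ S * I
    Q₁*Q₂≈[-a]^S*I = begin
      Q₁ * Q₂                                                         ≈⟨ prodL-distrib-* _ _ (others s) ⟨
      prodL (map (λ d → (y d ^ κ d) ⁻¹ * (u d ^ κ d) ⁻¹) (others s))  ≈⟨ prodL-cong (All.map [y^κ]⁻¹*[u^κ]⁻¹≈[-a]^κ*[t^κ]⁻¹ others-avoid-s) ⟩
      prodL (map (λ d → (- a) ^ κ d * (t d ^ κ d) ⁻¹) (others s))     ≈⟨ prodL-distrib-* _ _ (others s) ⟩
      prodL (map (λ d → (- a) ^ κ d) (others s)) * I                  ≈⟨ *-congʳ (prodL-^ (- a) κ (others s)) ⟩
      (- a) ^ S * I                                                   ∎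

    B-normal : ∀ r → B (λ j → y j ⁻¹) κ s r ≈ (- 1#) ^ S * Q₂ * ((- a) ^ (κ s ∸ r) * H (κ s ∸ r))
    B-normal r = *-cong (*-congʳ (reflexive (≡.cong ((- 1#) ^_) size∸κs≡S)))
                        (h-homogeneous (- a) (concatMap-replicate⁺ κ (All.map 1/u≈-a*[y/t] others-avoid-s)) (κ s ∸ r))

proposition7p4 : ∀ {c ℓ : Level} (F : Field c ℓ) → FieldDefs.CharZero F →
  (n : ℕ) (κ : Fin n → ℕ) → (∀ j → 1 ≤ κ j) →
  (s : Fin n) (r : ℕ) → 1 ≤ r → r ≤ κ s →
  (y : Fin n → Field.Carrier F) →
  (∀ j → ¬ (Field._≈_ F (y j) (Field.0# F))) →
  (∀ i j → ¬ (i ≡ j) → ¬ (Field._≈_ F (y i) (y j))) →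
  let open Field F
      open FieldDefs F
  in A y κ s r ≈
     (((- 1#) ^ (size κ ∸ r)) * ((y s ^ (κ s ∸ r)) ⁻¹)
       * prodL (map (λ d → (y d ^ κ d) ⁻¹) (others s))
       * B (λ j → y j ⁻¹) κ s r)
proposition7p4 F _ n κ _ s r _ r≤κs y y≉0 y-injective = begin
  A y κ s r                                                         ≈⟨ A-normal r ⟩
  (- a) ^ S * I * H m                                               ≈⟨ *-congʳ Q₁*Q₂≈[-a]^S*I ⟨
  Q₁ * Q₂ * H m                                                     ≈⟨ sign-cancel F (y≉0 s) S m Q₁ Q₂ (H m) ⟨
  (- 1#) ^ (S ℕ.+ m) * (a ^ m) ⁻¹ * Q₁ * ((- 1#) ^ S * Q₂ * ((- a) ^ m * H m))
                                                                    ≈⟨ *-cong (*-congʳ (*-congʳ (reflexive exponent)))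
                                                                              (B-normal r) ⟨
  (- 1#) ^ (size κ ∸ r) * (a ^ m) ⁻¹ * Q₁ * B (λ j → y j ⁻¹) κ s r  ∎
  where
  open Field F
  open FieldDefs F
  open Normalisation F κ s y y≉0 y-injective
  open SetoidReasoning setoid
  m : ℕ
  m = κ s ∸ r
  exponent : (- 1#) ^ (size κ ∸ r) ≡ (- 1#) ^ (S ℕ.+ m)
  exponent = ≡.cong ((- 1#) ^_) (size∸r≡S+κs∸r r≤κs)
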